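{- Let $\mathcal{A}$ be an oracle sequential algorithm of sort $U,V,X,Y$ which is computable. Then the induced partial functional $\Phi_{\mathcal{A}}:U\times Y^X\to V$ is computable, i.e. it can be computed by an oracle Turing machine (given $u$ and oracle access to $f$, the machine halts with output $\Phi_{\mathcal{A}}(u,f)$ whenever this value is defined).
   Context: Oracle sequential algorithm (OSA) of sort $U,V,X,Y$: tuple $(R,Q,E,\rho,\xi,\pi,\rhd)$ where $R$ is a set of registers; states are $\langle r\mid o\rangle$, $r\in R$, $o\in Y\cup\{\Box\}$ ($\Box$ fresh); $Q\subseteq\{\langle r\mid\Box\rangle\}$ query states; $E$ end states, $Q\cap E=\emptyset$; $\rho:U\to R$; $\xi:R\to X$; $\pi$ from states to $V$; $\rhd$ a partial function on states. A run on oracle $f:X\to Y$ is a finite sequence $s_0,\dots,s_n$, $s_i\notin E$ for $i<n$, with $s_{i+1}=\langle r\mid f(\xi(r))\rangle$ if $s_i=\langle r\mid\Box\rangle\in Q$ and $s_{i+1}=\rhd(s_i)$ if $s_i\notin Q$. $\Phi_{\mathcal{A}}(u,f):=\pi(t)$ if there is a run on $f$ from $\langle\rho(u)\mid\Box\rangle$ to $t\in E$, undefined otherwise. $\mathcal{A}$ is computable if, relative to some representations of $X,Y,U,V$ (and of the states), $\rho,\xi,\pi$ are computable, $\rhd$ is partial computable, and membership in $Q$ and in $E$ is decidable. -}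

module Defs where

open import Data.Nat using (ℕ; zero; suc; _+_)
open import Data.Fin using (Fin)
open import Data.Vec using (Vec; []; _∷_; lookup)
open import Data.Maybe using (Maybe; nothing; just)
open import Data.Product using (_×_; _,_; proj₁; proj₂; Σ; ∃)
open import Data.Empty using (⊥)
open import Relation.Nullary using (¬_)
open import Relation.Binary.PropositionalEquality using (_≡_)

-- Oracle computation model: partial recursive (μ-recursive) functions
-- relative to an oracle g : ℕ → ℕ  (Kleene; equivalent to oracle
-- Turing machines).  Codes are indexed by their arity.

data Code : ℕ → Set where
  zer  : ∀ {n} → Code n
  succ : Code 1
  proj : ∀ {n} → Fin n → Code n
  orc  : Code 1
  comp : ∀ {m n} → Code m → Vec (Code n) m → Code n
  prec : ∀ {n} → Code n → Code (suc (suc n)) → Code (suc n)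
  mu   : ∀ {n} → Code (suc n) → Code n

mutual
  data Eval (g : ℕ → ℕ) : ∀ {n} → Code n → Vec ℕ n → ℕ → Set where
    ev-zer  : ∀ {n} {xs : Vec ℕ n} → Eval g zer xs 0
    ev-succ : ∀ {x} → Eval g succ (x ∷ []) (suc x)
    ev-proj : ∀ {n} {i : Fin n} {xs} → Eval g (proj i) xs (lookup xs i)
    ev-orc  : ∀ {x} → Eval g orc (x ∷ []) (g x)
    ev-comp : ∀ {m n} {c : Code m} {cs : Vec (Code n) m} {xs ys y} →
              Evals g cs xs ys → Eval g c ys y → Eval g (comp c cs) xs y
    ev-prec-z : ∀ {n} {b : Code n} {s} {xs y} →
              Eval g b xs y → Eval g (prec b s) (0 ∷ xs) y
    ev-prec-s : ∀ {n} {b : Code n} {s} {k xs z y} →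
              Eval g (prec b s) (k ∷ xs) z → Eval g s (k ∷ z ∷ xs) y →
              Eval g (prec b s) (suc k ∷ xs) y
    ev-mu   : ∀ {n} {c : Code (suc n)} {xs y} →
              MuFrom g c xs 0 y → Eval g (mu c) xs y

  data Evals (g : ℕ → ℕ) {n : ℕ} : ∀ {m} → Vec (Code n) m → Vec ℕ n → Vec ℕ m → Set where
    evs-[] : ∀ {xs} → Evals g [] xs []
    evs-∷  : ∀ {m} {c : Code n} {cs : Vec (Code n) m} {xs y ys} →
             Eval g c xs y → Evals g cs xs ys → Evals g (c ∷ cs) xs (y ∷ ys)

  data MuFrom (g : ℕ → ℕ) {n : ℕ} (c : Code (suc n)) (xs : Vec ℕ n) : ℕ → ℕ → Set where
    mu-found : ∀ {k} → Eval g c (k ∷ xs) 0 → MuFrom g c xs k k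
    mu-next  : ∀ {k z y} → Eval g c (k ∷ xs) (suc z) →
               MuFrom g c xs (suc k) y → MuFrom g c xs k y

Eval₀ : ∀ {n} → Code n → Vec ℕ n → ℕ → Set
Eval₀ = Eval (λ _ → 0)

record Rep (T : Set) : Set where
  field
    enc : T → ℕ
open Rep public

tri : ℕ → ℕ
tri zero    = 0
tri (suc n) = suc n + tri n

pair : ℕ → ℕ → ℕ
pair a b = tri (a + b) + b

-- Y ∪ {□} represented by Maybe Y, with □ = nothing
encMaybe : ∀ {Y : Set} → Rep Y → Maybe Y → ℕ
encMaybe rY nothing  = 0
encMaybe rY (just y) = suc (enc rY y)

encState : ∀ {R Y : Set} → Rep R → Rep Y → R × Maybe Y → ℕ
encState rR rY (r , o) = pair (enc rR r) (encMaybe rY o)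

record OSA (U V X Y : Set) : Set₁ where
  field
    R   : Set
    Q   : R × Maybe Y → Set
    E   : R × Maybe Y → Set
    Q⊆□ : ∀ {s} → Q s → proj₂ s ≡ nothing
    Q∩E : ∀ {s} → Q s → E s → ⊥
    ρ   : U → R
    ξ   : R → X
    π   : R × Maybe Y → V
    _▷_ : R × Maybe Y → R × Maybe Y → Set          -- graph of ▷
    ▷-functional : ∀ {s t t'} → s ▷ t → s ▷ t' → t ≡ t'

  State : Set
  State = R × Maybe Y

  data Run (f : X → Y) : State → State → Set where
    run-end   : ∀ {s} → Run f s s
    run-query : ∀ {r t} → Q (r , nothing) → ¬ E (r , nothing) →
                Run f (r , just (f (ξ r))) t → Run f (r , nothing) t
    run-step  : ∀ {s s' t} → ¬ Q s → ¬ E s → s ▷ s' →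
                Run f s' t → Run f s t

  -- graph of the induced partial functional Φ_A
  Φ : U → (X → Y) → V → Set
  Φ u f v = Σ State λ t → Run f (ρ u , nothing) t × E t × π t ≡ v

record IsComputable {U V X Y : Set} (A : OSA U V X Y)
    (rU : Rep U) (rV : Rep V) (rX : Rep X) (rY : Rep Y) (rR : Rep (OSA.R A)) : Set where
  open OSA A
  encS : State → ℕ
  encS = encState rR rY
  field
    ρ-comp : Σ (Code 1) λ c → ∀ u → Eval₀ c (enc rU u ∷ []) (enc rR (ρ u))
    ξ-comp : Σ (Code 1) λ c → ∀ r → Eval₀ c (enc rR r ∷ []) (enc rX (ξ r))
    π-comp : Σ (Code 1) λ c → ∀ s → Eval₀ c (encS s ∷ []) (enc rV (π s))
    ▷-comp : Σ (Code 1) λ c →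
               (∀ s t → s ▷ t → Eval₀ c (encS s ∷ []) (encS t)) ×
               (∀ s n → Eval₀ c (encS s ∷ []) n → Σ State λ t → s ▷ t × n ≡ encS t)
    Q-dec  : Σ (Code 1) λ c → ∀ s →
               (Q s → Eval₀ c (encS s ∷ []) 1) × (¬ Q s → Eval₀ c (encS s ∷ []) 0)
    E-dec  : Σ (Code 1) λ c → ∀ s →
               (E s → Eval₀ c (encS s ∷ []) 1) × (¬ E s → Eval₀ c (encS s ∷ []) 0)

module Submission where

-- A run of A is a while-loop over states: starting from ⟨ρ(u) ∣ □⟩,
-- repeat "one transition" until an end state is reached, then output π of
-- it.  One transition is itself computable from the oracle: a query state
-- ⟨r ∣ □⟩ goes to ⟨r ∣ f(ξ r)⟩ (decode r, compute ξ r, ask the oracle, re-encode),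
-- any other state goes to ▷ of it.  So Φ_A is a composition of a few
-- computable pieces with one unbounded search.

open import Defs
open import Data.Nat using (ℕ; zero; suc; _+_; _∸_; _<_; _≤_; s≤s; z≤n; pred)
open import Data.Nat.Properties
  using (+-identityʳ; +-suc; +-mono-≤; m≤m+n; m≤n+m; ≤-trans; n∸n≡0;
         pred[m∸n]≡m∸[1+n]; m<n⇒0<n∸m)
open import Data.Fin using () renaming (zero to f0; suc to fs)
open import Data.Vec using (Vec; []; _∷_)
open import Data.Maybe using (nothing; just)
open import Data.Product using (Σ; _,_; proj₁; proj₂; _×_)
open import Relation.Nullary using (¬_)
open import Relation.Binary.PropositionalEquality using (_≡_; refl; sym; trans; cong; subst)

-- Replace every oracle call by the constant 0.  Under the trivial oracle
-- this changes nothing, and afterwards the oracle is never consulted.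
mutual
  dropOracle : ∀ {n} → Code n → Code n
  dropOracle zer         = zer
  dropOracle succ        = succ
  dropOracle (proj i)    = proj i
  dropOracle orc         = zer
  dropOracle (comp c cs) = comp (dropOracle c) (dropOracles cs)
  dropOracle (prec b s)  = prec (dropOracle b) (dropOracle s)
  dropOracle (mu c)      = mu (dropOracle c)

  dropOracles : ∀ {m n} → Vec (Code n) m → Vec (Code n) m
  dropOracles []       = []
  dropOracles (c ∷ cs) = dropOracle c ∷ dropOracles cs

-- Hence a function computable without oracle (the data of IsComputable) is
-- computed by one fixed code under every oracle g.
module _ {g : ℕ → ℕ} where
  mutual
    dropOracle-sound : ∀ {n} {c : Code n} {xs y} →
                       Eval₀ c xs y → Eval g (dropOracle c) xs y
    dropOracle-sound ev-zer           = ev-zer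
    dropOracle-sound ev-succ          = ev-succ
    dropOracle-sound ev-proj          = ev-proj
    dropOracle-sound ev-orc           = ev-zer
    dropOracle-sound (ev-comp es e)   = ev-comp (dropOracles-sound es) (dropOracle-sound e)
    dropOracle-sound (ev-prec-z e)    = ev-prec-z (dropOracle-sound e)
    dropOracle-sound (ev-prec-s e e') = ev-prec-s (dropOracle-sound e) (dropOracle-sound e')
    dropOracle-sound (ev-mu m)        = ev-mu (dropOracle-search m)

    dropOracles-sound : ∀ {n m} {cs : Vec (Code n) m} {xs ys} →
                        Evals (λ _ → 0) cs xs ys → Evals g (dropOracles cs) xs ys
    dropOracles-sound evs-[]       = evs-[]
    dropOracles-sound (evs-∷ e es) = evs-∷ (dropOracle-sound e) (dropOracles-sound es)

    dropOracle-search : ∀ {n} {c : Code (suc n)} {xs k y} →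
                        MuFrom (λ _ → 0) c xs k y → MuFrom g (dropOracle c) xs k y
    dropOracle-search (mu-found e)  = mu-found (dropOracle-sound e)
    dropOracle-search (mu-next e m) = mu-next (dropOracle-sound e) (dropOracle-search m)

p₀ : ∀ {n} → Code (suc n)
p₀ = proj f0

p₁ : ∀ {n} → Code (suc (suc n))
p₁ = proj (fs f0)

p₂ : ∀ {n} → Code (suc (suc (suc n)))
p₂ = proj (fs (fs f0))

infixr 9 _·_

_·_ : ∀ {n} → Code 1 → Code n → Code n
c · d = comp c (d ∷ [])

_⟨_,_⟩ : ∀ {n} → Code 2 → Code n → Code n → Code n
c ⟨ d , e ⟩ = comp c (d ∷ e ∷ [])

one : ∀ {n} → Code n
one = succ · zer

module _ {g : ℕ → ℕ} where
  ·-eval : ∀ {n} {c : Code 1} {d : Code n} {xs y z} →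
           Eval g d xs y → Eval g c (y ∷ []) z → Eval g (c · d) xs z
  ·-eval ed ec = ev-comp (evs-∷ ed evs-[]) ec

  ⟨⟩-eval : ∀ {n} {c : Code 2} {d e : Code n} {xs y y' z} →
            Eval g d xs y → Eval g e xs y' → Eval g c (y ∷ y' ∷ []) z →
            Eval g (c ⟨ d , e ⟩) xs z
  ⟨⟩-eval ed ee ec = ev-comp (evs-∷ ed (evs-∷ ee evs-[])) ec

  one-eval : ∀ {n} {xs : Vec ℕ n} → Eval g one xs 1
  one-eval = ·-eval ev-zer ev-succ

  mu-least : ∀ {n} {c : Code (suc n)} {xs} a →
             (∀ j → j < a → Σ ℕ λ z → Eval g c (j ∷ xs) z × 0 < z) →
             Eval g c (a ∷ xs) 0 → Eval g (mu c) xs a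
  mu-least {c = c} {xs} a positive found = ev-mu (search a 0 refl)
    where
      search : ∀ d j → j + d ≡ a → MuFrom g c xs j a
      search zero j j≡a =
        subst (λ i → MuFrom g c xs i a) (sym (trans (sym (+-identityʳ j)) j≡a)) (mu-found found)
      search (suc d) j j+d≡a with positive j j<a
        where
          j<a : j < a
          j<a = subst (j <_) (trans (sym (+-suc j d)) j+d≡a) (s≤s (m≤m+n j d))
      ... | suc _ , e , _ = mu-next e (search d (suc j) (trans (sym (+-suc j d)) j+d≡a))

addC : Code 2
addC = prec p₀ (succ · p₁)

predC : Code 1
predC = prec zer p₀

-- monus (k , m) = m ∸ k
monusC : Code 2
monusC = prec p₀ (predC · p₁)

triC : Code 1
triC = prec zer (addC ⟨ succ · p₀ , p₁ ⟩)

pairC : Code 2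
pairC = addC ⟨ triC · addC , p₁ ⟩

-- least j with n ≤ tri j; it inverts tri, hence decodes ⟨r ∣ □⟩ = pair r 0
triInvC : Code 1
triInvC = mu (monusC ⟨ triC · p₀ , p₁ ⟩)

-- tri is strictly increasing; this makes the search in triInvC exact
tri-mono-≤ : ∀ {j a} → j ≤ a → tri j ≤ tri a
tri-mono-≤ z≤n     = z≤n
tri-mono-≤ (s≤s p) = +-mono-≤ (s≤s p) (tri-mono-≤ p)

tri-mono-< : ∀ {j a} → j < a → tri j < tri a
tri-mono-< {a = suc a} (s≤s p) = s≤s (≤-trans (tri-mono-≤ p) (m≤n+m (tri a) a))

module _ {g : ℕ → ℕ} where
  add-eval : ∀ k m → Eval g addC (k ∷ m ∷ []) (k + m)
  add-eval zero    m = ev-prec-z ev-proj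
  add-eval (suc k) m = ev-prec-s (add-eval k m) (·-eval ev-proj ev-succ)

  pred-eval : ∀ m → Eval g predC (m ∷ []) (pred m)
  pred-eval zero    = ev-prec-z ev-zer
  pred-eval (suc k) = ev-prec-s (pred-eval k) ev-proj

  monus-eval : ∀ k m → Eval g monusC (k ∷ m ∷ []) (m ∸ k)
  monus-eval zero    m = ev-prec-z ev-proj
  monus-eval (suc k) m =
    subst (Eval g monusC (suc k ∷ m ∷ [])) (pred[m∸n]≡m∸[1+n] m k)
      (ev-prec-s (monus-eval k m) (·-eval ev-proj (pred-eval (m ∸ k))))

  tri-eval : ∀ k → Eval g triC (k ∷ []) (tri k)
  tri-eval zero    = ev-prec-z ev-zer
  tri-eval (suc k) =
    ev-prec-s (tri-eval k) (⟨⟩-eval (·-eval ev-proj ev-succ) ev-proj (add-eval (suc k) (tri k)))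

  pair-eval : ∀ a b → Eval g pairC (a ∷ b ∷ []) (pair a b)
  pair-eval a b = ⟨⟩-eval (·-eval (add-eval a b) (tri-eval (a + b))) ev-proj (add-eval _ b)

  triInv-tri : ∀ a → Eval g triInvC (tri a ∷ []) a
  triInv-tri a = mu-least a positive (subst (Eval g _ _) (n∸n≡0 (tri a)) (distance a))
    where
      distance : ∀ j → Eval g (monusC ⟨ triC · p₀ , p₁ ⟩) (j ∷ tri a ∷ []) (tri a ∸ tri j)
      distance j = ⟨⟩-eval (·-eval ev-proj (tri-eval j)) ev-proj (monus-eval (tri j) (tri a))
      positive : ∀ j → j < a → Σ ℕ λ z → Eval g _ (j ∷ tri a ∷ []) z × 0 < z
      positive j j<a = tri a ∸ tri j , distance j , m<n⇒0<n∸m (tri-mono-< j<a)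

  triInv-pair0 : ∀ a → Eval g triInvC (pair a 0 ∷ []) a
  triInv-pair0 a = subst (λ n → Eval g triInvC (n ∷ []) a)
    (sym (trans (+-identityʳ _) (cong tri (+-identityʳ a)))) (triInv-tri a)

-- whenC t c x = c x if t x = 1, and 0 if t x = 0 (without evaluating c)
whenC : Code 1 → Code 1 → Code 1
whenC t c = prec zer (c · p₂) ⟨ t , p₀ ⟩

notC : Code 1 → Code 1
notC t = monusC ⟨ t , one ⟩

ifC : Code 1 → Code 1 → Code 1 → Code 1
ifC t a b = addC ⟨ whenC t a , whenC (notC t) b ⟩

iterateC : Code 1 → Code 2
iterateC step = prec p₀ (step · p₁)

-- iterate step from x until the test t yields 1; return the state reached
untilC : Code 1 → Code 1 → Code 1
untilC t step = iterateC step ⟨ mu (notC t · iterateC step) , p₀ ⟩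

data Trace (g : ℕ → ℕ) (t step : Code 1) : ℕ → ℕ → Set where
  halt     : ∀ {y} → Eval g t (y ∷ []) 1 → Trace g t step y y
  continue : ∀ {x x' y} → Eval g t (x ∷ []) 0 → Eval g step (x ∷ []) x' →
             Trace g t step x' y → Trace g t step x y

module _ {g : ℕ → ℕ} where
  when-true : ∀ {t c x y} → Eval g t (x ∷ []) 1 → Eval g c (x ∷ []) y →
              Eval g (whenC t c) (x ∷ []) y
  when-true et ec = ⟨⟩-eval et ev-proj (ev-prec-s (ev-prec-z ev-zer) (·-eval ev-proj ec))

  when-false : ∀ {t c x} → Eval g t (x ∷ []) 0 → Eval g (whenC t c) (x ∷ []) 0
  when-false et = ⟨⟩-eval et ev-proj (ev-prec-z ev-zer)

  not-eval : ∀ {t xs} b → Eval g t xs b → Eval g (notC t) xs (1 ∸ b)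
  not-eval b et = ⟨⟩-eval et one-eval (monus-eval b 1)

  if-true : ∀ {t a b x y} → Eval g t (x ∷ []) 1 → Eval g a (x ∷ []) y →
            Eval g (ifC t a b) (x ∷ []) y
  if-true {y = y} et ea = subst (Eval g _ _) (+-identityʳ y)
    (⟨⟩-eval (when-true et ea) (when-false (not-eval 1 et)) (add-eval y 0))

  if-false : ∀ {t a b x y} → Eval g t (x ∷ []) 0 → Eval g b (x ∷ []) y →
             Eval g (ifC t a b) (x ∷ []) y
  if-false {y = y} et eb =
    ⟨⟩-eval (when-false et) (when-true (not-eval 0 et) eb) (add-eval 0 y)

  -- Along a halting trace the loop returns the final state.  Generalised
  -- form: if x is the k-th iterate of x₀, the search started at k stops at
  -- some N whose iterate is y.
  until-sound : ∀ {t step x y} → Trace g t step x y → Eval g (untilC t step) (x ∷ []) y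
  until-sound {t} {step} {x} tr with search tr 0 (ev-prec-z ev-proj)
    where
      search : ∀ {x' y} → Trace g t step x' y → ∀ k → Eval g (iterateC step) (k ∷ x ∷ []) x' →
               Σ ℕ λ N → MuFrom g (notC t · iterateC step) (x ∷ []) k N ×
                         Eval g (iterateC step) (N ∷ x ∷ []) y
      search (halt et) k it = k , mu-found (·-eval it (not-eval 1 et)) , it
      search (continue et es tr') k it with search tr' (suc k) (ev-prec-s it (·-eval ev-proj es))
      ... | N , m , it' = N , mu-next (·-eval it (not-eval 0 et)) m , it'
  ... | N , m , it = ⟨⟩-eval (ev-mu m) ev-proj it

module Simulation {U V X Y : Set} (A : OSA U V X Y)
    (rU : Rep U) (rV : Rep V) (rX : Rep X) (rY : Rep Y) (rR : Rep (OSA.R A))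
    (ic : IsComputable A rU rV rX rY rR) where
  open OSA A
  open IsComputable ic

  ρC ξC πC ▷C QC EC : Code 1
  ρC = dropOracle (proj₁ ρ-comp)
  ξC = dropOracle (proj₁ ξ-comp)
  πC = dropOracle (proj₁ π-comp)
  ▷C = dropOracle (proj₁ ▷-comp)
  QC = dropOracle (proj₁ Q-dec)
  EC = dropOracle (proj₁ E-dec)

  registerC answerC queryC : Code 1
  registerC = triInvC
  answerC   = succ · orc · ξC · registerC
  queryC    = pairC ⟨ registerC , answerC ⟩

  stepC initC mainC : Code 1
  stepC = ifC QC queryC ▷C
  initC = pairC ⟨ ρC , zer ⟩
  mainC = πC · untilC EC stepC · initC

  module _ (f : X → Y) (g : ℕ → ℕ) (g-names-f : ∀ x → g (enc rX x) ≡ enc rY (f x)) where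
    query-eval : ∀ r → Eval g queryC (encS (r , nothing) ∷ []) (encS (r , just (f (ξ r))))
    query-eval r = ⟨⟩-eval register-eval answer-eval (pair-eval _ _)
      where
        register-eval : Eval g registerC (encS (r , nothing) ∷ []) (enc rR r)
        register-eval = triInv-pair0 (enc rR r)
        answer-eval : Eval g answerC (encS (r , nothing) ∷ []) (suc (enc rY (f (ξ r))))
        answer-eval =
          ·-eval (·-eval (·-eval register-eval (dropOracle-sound (proj₂ ξ-comp r)))
                         (subst (Eval g orc _) (g-names-f (ξ r)) ev-orc))
                 ev-succ

    step-query : ∀ r → Q (r , nothing) →
                 Eval g stepC (encS (r , nothing) ∷ []) (encS (r , just (f (ξ r))))
    step-query r q = if-true (dropOracle-sound (proj₁ (proj₂ Q-dec _) q)) (query-eval r)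

    step-internal : ∀ s s' → ¬ Q s → s ▷ s' → Eval g stepC (encS s ∷ []) (encS s')
    step-internal s s' nq st =
      if-false (dropOracle-sound (proj₂ (proj₂ Q-dec s) nq))
               (dropOracle-sound (proj₁ (proj₂ ▷-comp) s s' st))

    run-trace : ∀ {s t} → Run f s t → E t → Trace g EC stepC (encS s) (encS t)
    run-trace {s} run-end et = halt (dropOracle-sound (proj₁ (proj₂ E-dec s) et))
    run-trace (run-query {r} q ne rest) et =
      continue (dropOracle-sound (proj₂ (proj₂ E-dec _) ne)) (step-query r q) (run-trace rest et)
    run-trace (run-step {s} {s'} nq ne st rest) et =
      continue (dropOracle-sound (proj₂ (proj₂ E-dec s) ne)) (step-internal s s' nq st)
               (run-trace rest et)

    main-eval : ∀ u v → Φ u f v → Eval g mainC (enc rU u ∷ []) (enc rV v)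
    main-eval u v (t , run , et , πt≡v) =
      ·-eval (·-eval init-eval (until-sound (run-trace run et)))
             (subst (Eval g πC _) (cong (enc rV) πt≡v) (dropOracle-sound (proj₂ π-comp t)))
      where
        init-eval : Eval g initC (enc rU u ∷ []) (encS (ρ u , nothing))
        init-eval = ⟨⟩-eval (dropOracle-sound (proj₂ ρ-comp u)) ev-zer (pair-eval _ 0)

proposition3p17 : {U V X Y : Set} (A : OSA U V X Y)
    (rU : Rep U) (rV : Rep V) (rX : Rep X) (rY : Rep Y) (rR : Rep (OSA.R A)) →
    IsComputable A rU rV rX rY rR →
    Σ (Code 1) λ c →
    ∀ (u : U) (f : X → Y) (v : V) → OSA.Φ A u f v →
    ∀ (g : ℕ → ℕ) → (∀ x → g (enc rX x) ≡ enc rY (f x)) →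
    Eval g c (enc rU u ∷ []) (enc rV v)
proposition3p17 A rU rV rX rY rR ic = mainC , λ u f v φ g g-names-f → main-eval f g g-names-f u v φ
  where open Simulation A rU rV rX rY rR ic
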